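{- Let $a,b,n$ be integers with $n\ge a+b$ and $2\le a\le b$. Then $$\binom{n-1}{a-1}+\binom{n-1}{b-1}\le\binom{n}{b}-\binom{n-a+1}{b}+n-a+1.$$ -}

-- Pascal's rule for C(n, b) cancels C(n−1, b−1) from both sides, leaving
-- C(m, a−1) + C(r, b) ≤ C(m, b) + r  with m = n−1 and r = n−a+1.  Keep r fixed and induct on a
-- (so m = a + r − 2 moves with it): for a = 2 both sides agree since C(r, 1) = r, and Pascal's
-- rule applied to C(m, a−1) and C(m, b) reduces the step to the case a−1 together with
-- C(m−1, a−1) ≤ C(m−1, b−1).  That holds because a−1 ≤ b−1 ≤ (m−1) − (a−1): binomial
-- coefficients grow towards the middle of a row.
module Submission where

open import Data.Nat using (ℕ; zero; suc; _+_; _∸_; _≤_; _<_; z≤n; s≤s; s≤s⁻¹)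
open import Data.Nat.Combinatorics using (_C_; nC1≡n; nCk+nC[k+1]≡[n+1]C[k+1])
open import Data.Nat.Properties
import Algebra.Properties.CommutativeSemigroup as CommutativeSemigroupProperties
open import Data.Product using (_,_)
open import Data.Sum using (inj₁; inj₂)
open import Relation.Binary.PropositionalEquality using (_≡_; refl; sym; trans; cong; subst)

k≤n⇒nCk>0 : ∀ {n k} → k ≤ n → 0 < n C k
k≤n⇒nCk>0 {n}     {zero}  _         = s≤s z≤n
k≤n⇒nCk>0 {suc n} {suc k} (s≤s k≤n) =
  subst (0 <_) (nCk+nC[k+1]≡[n+1]C[k+1] n k) (<-≤-trans (k≤n⇒nCk>0 k≤n) (m≤m+n _ _))

-- Pascal's rule on both sides, comparing the summands crosswise: C(n−1, k−1) ≤ C(n−1, j) and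
-- C(n−1, k) ≤ C(n−1, j−1).
k≤j⇒j+k≤n⇒nCk≤nCj : ∀ {n k j} → k ≤ j → j + k ≤ n → n C k ≤ n C j
k≤j⇒j+k≤n⇒nCk≤nCj {n}     {zero}  {j}     _   j≤n = k≤n⇒nCk>0 (subst (_≤ n) (+-identityʳ j) j≤n)
k≤j⇒j+k≤n⇒nCk≤nCj {suc n} {suc k} {suc j} k≤j j+k<n with m≤n⇒m<n∨m≡n (s≤s⁻¹ k≤j)
... | inj₂ refl = ≤-refl
... | inj₁ k<j  = begin
  suc n C suc k       ≡⟨ nCk+nC[k+1]≡[n+1]C[k+1] n k ⟨
  n C k + n C suc k   ≤⟨ +-mono-≤ (k≤j⇒j+k≤n⇒nCk≤nCj (m≤n⇒m≤1+n (<⇒≤ k<j)) j+1+k≤n)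
                                  (k≤j⇒j+k≤n⇒nCk≤nCj k<j j+[1+k]≤n) ⟩
  n C suc j + n C j   ≡⟨ +-comm (n C suc j) (n C j) ⟩
  n C j + n C suc j   ≡⟨ nCk+nC[k+1]≡[n+1]C[k+1] n j ⟩
  suc n C suc j       ∎
  where
  open ≤-Reasoning
  j+[1+k]≤n : j + suc k ≤ n
  j+[1+k]≤n = s≤s⁻¹ j+k<n
  j+1+k≤n : suc j + k ≤ n
  j+1+k≤n = subst (_≤ n) (+-suc j k) j+[1+k]≤n

x+y≤u+w⇒z≤v⇒x+z+y≤v+u+w : ∀ x y u w {z v} → x + y ≤ u + w → z ≤ v → x + z + y ≤ v + u + w
x+y≤u+w⇒z≤v⇒x+z+y≤v+u+w x y u w {z} {v} x+y≤u+w z≤v = begin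
  x + z + y  ≡⟨ xy∙z≈xz∙y x y z ⟨
  x + y + z  ≤⟨ +-mono-≤ x+y≤u+w z≤v ⟩
  u + w + v  ≡⟨ xy∙z≈zx∙y u w v ⟩
  v + u + w  ∎
  where
  open ≤-Reasoning
  open CommutativeSemigroupProperties +-commutativeSemigroup

[1+k+s]C[1+k]+[1+s]Cb≤[1+k+s]Cb+[1+s] : ∀ k s b → suc k < b → b ≤ s →
  (suc k + s) C suc k + suc s C b ≤ (suc k + s) C b + suc s
[1+k+s]C[1+k]+[1+s]Cb≤[1+k+s]Cb+[1+s] zero s b _ _ =
  ≤-reflexive (trans (cong (_+ suc s C b) (nC1≡n (suc s))) (+-comm (suc s) (suc s C b)))
[1+k+s]C[1+k]+[1+s]Cb≤[1+k+s]Cb+[1+s] (suc k) s (suc b) 2+k<1+b 1+b≤s = begin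
  suc m C suc (suc k) + suc s C suc b          ≡⟨ cong (_+ suc s C suc b) (nCk+nC[k+1]≡[n+1]C[k+1] m (suc k)) ⟨
  m C suc k + m C suc (suc k) + suc s C suc b  ≤⟨ x+y≤u+w⇒z≤v⇒x+z+y≤v+u+w (m C suc k) (suc s C suc b) (m C suc b) (suc s)
                                                   induction-hypothesis central-bound ⟩
  m C b + m C suc b + suc s                    ≡⟨ cong (_+ suc s) (nCk+nC[k+1]≡[n+1]C[k+1] m b) ⟩
  suc m C suc b + suc s                        ∎
  where
  open ≤-Reasoning
  m : ℕ
  m = suc k + s
  induction-hypothesis : m C suc k + suc s C suc b ≤ m C suc b + suc s
  induction-hypothesis = [1+k+s]C[1+k]+[1+s]Cb≤[1+k+s]Cb+[1+s] k s (suc b) (<⇒≤ 2+k<1+b) 1+b≤s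
  central-bound : m C suc (suc k) ≤ m C b
  central-bound = k≤j⇒j+k≤n⇒nCk≤nCj (s≤s⁻¹ 2+k<1+b)
    (subst (_≤ m) (trans (cong suc (+-suc k b)) (+-comm (suc (suc k)) b)) (+-monoʳ-≤ (suc k) 1+b≤s))

lemma5p2 : (a b n : ℕ) → 2 ≤ a → a ≤ b → a + b ≤ n →
    ((n ∸ 1) C (a ∸ 1)) + ((n ∸ 1) C (b ∸ 1)) + ((n ∸ a + 1) C b)
      ≤ (n C b) + (n ∸ a + 1)
lemma5p2 (suc (suc k)) (suc b) n (s≤s (s≤s z≤n)) a≤b a+b≤n
  with m≤n⇒∃[o]m+o≡n (≤-trans (m≤m+n (suc (suc k)) (suc b)) a+b≤n)
... | s , refl = subst (λ r → m C suc k + m C b + r C suc b ≤ suc m C suc b + r) (sym n∸a+1≡1+s) (begin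
  m C suc k + m C b + suc s C suc b  ≤⟨ x+y≤u+w⇒z≤v⇒x+z+y≤v+u+w (m C suc k) (suc s C suc b) (m C suc b) (suc s)
                                         bound ≤-refl ⟩
  m C b + m C suc b + suc s          ≡⟨ cong (_+ suc s) (nCk+nC[k+1]≡[n+1]C[k+1] m b) ⟩
  suc m C suc b + suc s              ∎)
  where
  open ≤-Reasoning
  m : ℕ
  m = suc k + s
  1+b≤s : suc b ≤ s
  1+b≤s = +-cancelˡ-≤ (suc (suc k)) (suc b) s a+b≤n
  bound : m C suc k + suc s C suc b ≤ m C suc b + suc s
  bound = [1+k+s]C[1+k]+[1+s]Cb≤[1+k+s]Cb+[1+s] k s (suc b) a≤b 1+b≤s
  n∸a+1≡1+s : k + s ∸ k + 1 ≡ suc s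
  n∸a+1≡1+s = trans (cong (_+ 1) (m+n∸m≡n k s)) (+-comm s 1)
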